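{- Let $G=(V,E)$ be a connected simple graph and let $v\in V$. If $\deg_v > 2^{\beta_M(G)-1}-1$, then $v$ does not belong to any mixed resolving set $S$ of $G$ with $|S|=\beta_M(G)$.
   Context: For vertices $u,v$, $d(u,v)$ is the number of edges on a shortest $u$–$v$ path. For a vertex $w$ and an edge $e=uv$, $d(w,e)=\min(d(w,u),d(w,v))$. A vertex $w$ resolves two elements $x,y\in V\cup E$ if $d(w,x)\neq d(w,y)$. A set $S\subseteq V$ is a mixed resolving set if every pair of distinct elements of $V\cup E$ is resolved by some element of $S$. The mixed metric dimension $\beta_M(G)$ is the minimum cardinality of a mixed resolving set of $G$. $\deg_v$ denotes the degree of $v$. -}

module Defs where

open import Data.Nat using (ℕ; zero; suc; _≤_; _⊓_)
open import Data.Bool using (Bool; true; false; T)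
open import Data.Unit using (⊤)
open import Data.Fin using (Fin) renaming (_<_ to _<ᶠ_)
open import Data.Fin.Subset using (Subset; _∈_; ∣_∣)
open import Data.Vec using (tabulate)
open import Data.Product using (Σ; ∃; _×_; ∃-syntax)
open import Relation.Binary.PropositionalEquality using (_≡_; _≢_)
open import Relation.Nullary using (¬_)

record Graph : Set where
  field
    n      : ℕ
    adj    : Fin n → Fin n → Bool
    sym    : ∀ u v → adj u v ≡ adj v u
    irrefl : ∀ u → adj u u ≡ false

module _ (G : Graph) where
  open Graph G

  data Walk : Fin n → Fin n → ℕ → Set where
    here : ∀ {u} → Walk u u zero
    step : ∀ {u w v k} → T (adj u w) → Walk w v k → Walk u v (suc k)

  Connected : Set
  Connected = ∀ u v → ∃[ k ] Walk u v k

  IsDist : Fin n → Fin n → ℕ → Set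
  IsDist u v k = Walk u v k × (∀ m → Walk u v m → k ≤ m)

  -- elements of V ∪ E; an edge is written edge u v with u < v (see IsElem)
  data Elem : Set where
    vertex : Fin n → Elem
    edge   : Fin n → Fin n → Elem

  IsElem : Elem → Set
  IsElem (vertex u) = ⊤
  IsElem (edge u v) = (u <ᶠ v) × T (adj u v)

  IsDistE : Fin n → Elem → ℕ → Set
  IsDistE w (vertex u) k = IsDist w u k
  IsDistE w (edge u v) k = ∃[ a ] ∃[ b ] (IsDist w u a × IsDist w v b × k ≡ a ⊓ b)

  Resolves : Fin n → Elem → Elem → Set
  Resolves w x y = ∀ k l → IsDistE w x k → IsDistE w y l → k ≢ l

  IsMixedResolving : Subset n → Set
  IsMixedResolving S = ∀ x y → IsElem x → IsElem y → x ≢ y →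
                       ∃[ w ] (w ∈ S × Resolves w x y)

  IsMixedMetricDim : ℕ → Set
  IsMixedMetricDim b =
    (∃[ S ] (IsMixedResolving S × ∣ S ∣ ≡ b)) ×
    (∀ S → IsMixedResolving S → b ≤ ∣ S ∣)

  deg : Fin n → ℕ
  deg v = ∣ tabulate (adj v) ∣

module Submission where

-- If v belongs to a mixed resolving set S, then v, together with the deg v
-- edges at v, forms a family of deg v + 1 distinct elements of V ∪ E.  For
-- every vertex w the distance from w to any member of this family is either
-- d(w,v) or d(w,v) - 1, so the bit "does the distance equal d(w,v)?" records
-- all the information w has about the family.  Hence the members receive
-- pairwise distinct binary codes indexed by S, and all codes agree at the
-- coordinate v itself (there every distance is 0).  Such codes live in a set
-- of size 2^(|S|-1), giving 2 (deg v + 1) ≤ 2^|S|; with |S| = β_M(G) this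
-- contradicts the hypothesis deg v > 2^(β_M(G)-1) - 1.

open import Defs
open import Data.Nat using (ℕ; zero; suc; _+_; _*_; _^_; _≤_; _<_; _⊓_; _≟_; z≤n)
open import Data.Nat.Properties
  using (≤-refl; ≤-antisym; ≤∧≢⇒<; ≮⇒≥; n≤1+n; n≤0⇒n≡0; ⊓-glb; m⊓n≤m;
         ⊓-comm; *-monoʳ-≤; ^-monoʳ-≤; <⇒≱; suc-injective; m<1+n⇒m<n∨m≡n;
         +-identityʳ; +-suc)
open import Data.Bool using (Bool; true; false; T; T?)
open import Data.Bool.Properties using (T-≡)
open import Data.Unit using (tt)
open import Data.Fin using (Fin; zero; suc; combine; _<?_)
import Data.Fin.Properties as Fin
open import Data.Fin.Subset using (Subset; inside; outside; _∈_; _∉_; _-_; ∣_∣)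
open import Data.Fin.Subset.Properties using (x∈p∧x≢y⇒x∈p-y; x∈p⇒∣p-x∣<∣p∣)
open import Data.Vec using ([]; _∷_; tabulate; here; there)
open import Data.Vec.Properties using ([]=⇒lookup; lookup∘tabulate)
open import Data.Product using (∃; ∃-syntax; _×_; _,_; proj₁; proj₂)
open import Data.Sum using (inj₁; inj₂)
open import Data.Empty using (⊥-elim)
open import Function using (_∘_; Injective; Equivalence)
open import Relation.Nullary using (Dec; yes; no; does; ¬_; _×-dec_)
open import Relation.Nullary.Decidable using (dec-true)
open import Relation.Binary.PropositionalEquality
  using (_≡_; _≢_; refl; sym; trans; cong; subst)

Separates : ∀ {n} → Subset n → (Fin n → Bool) → (Fin n → Bool) → Set
Separates S g h = ∃[ i ] (i ∈ S × g i ≢ h i)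

bit : Bool → Fin 2
bit false = zero
bit true  = suc zero

bit-injective : ∀ {a b} → bit a ≡ bit b → a ≡ b
bit-injective {false} {false} _ = refl
bit-injective {true}  {true}  _ = refl

encode : ∀ {n} (S : Subset n) → (Fin n → Bool) → Fin (2 ^ ∣ S ∣)
encode []            g = zero
encode (outside ∷ S) g = encode S (g ∘ suc)
encode (inside  ∷ S) g = combine (bit (g zero)) (encode S (g ∘ suc))

encode-separates : ∀ {n} (S : Subset n) {g h} → Separates S g h →
                   encode S g ≢ encode S h
encode-separates (inside ∷ S) {g} {h} (zero , _ , g≢h) eq =
  g≢h (bit-injective (Fin.combine-injectiveˡ (bit (g zero)) _ (bit (h zero)) _ eq))
encode-separates (inside ∷ S) {g} {h} (suc i , there i∈S , g≢h) eq =
  encode-separates S (i , i∈S , g≢h)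
    (Fin.combine-injectiveʳ (bit (g zero)) _ (bit (h zero)) _ eq)
encode-separates (outside ∷ S) (suc i , there i∈S , g≢h) =
  encode-separates S (i , i∈S , g≢h)

separated-codes-bound : ∀ {n k} (S : Subset n) (c : Fin k → Fin n → Bool) →
                        (∀ {i j} → i ≢ j → Separates S (c i) (c j)) → k ≤ 2 ^ ∣ S ∣
separated-codes-bound S c sep = Fin.injective⇒≤ encode-injective
  where
  encode-injective : Injective _≡_ _≡_ (encode S ∘ c)
  encode-injective {i} {j} eq with i Fin.≟ j
  ... | yes i≡j = i≡j
  ... | no  i≢j = ⊥-elim (encode-separates S (sep i≢j) eq)

separates-without : ∀ {n} {S : Subset n} {p g h} → g p ≡ h p →
                    Separates S g h → Separates (S - p) g h
separates-without {p = p} gp≡hp (i , i∈S , g≢h) =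
  i , x∈p∧x≢y⇒x∈p-y i∈S (λ { refl → g≢h gp≡hp }) , g≢h

agreeing-codes-bound : ∀ {n} {k} (S : Subset n) {p} → p ∈ S → (c : Fin k → Fin n → Bool) →
                       (∀ i j → c i p ≡ c j p) →
                       (∀ {i j} → i ≢ j → Separates S (c i) (c j)) → 2 * k ≤ 2 ^ ∣ S ∣
agreeing-codes-bound {k = k} S {p} p∈S c agree sep = begin
  2 * k                 ≤⟨ *-monoʳ-≤ 2 (separated-codes-bound (S - p) c
                             (λ {i} {j} i≢j → separates-without (agree i j) (sep i≢j))) ⟩
  2 ^ suc ∣ S - p ∣      ≤⟨ ^-monoʳ-≤ 2 (x∈p⇒∣p-x∣<∣p∣ p∈S) ⟩
  2 ^ ∣ S ∣             ∎
  where open Data.Nat.Properties.≤-Reasoning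

-- The
-- search walks upwards from start, knowing P fails below start, and stops at
-- the latest when it reaches the given witness start + fuel.
least-witness : (P : ℕ → Set) → (∀ m → Dec (P m)) → ∃ P →
                ∃[ m ] (P m × ∀ j → P j → m ≤ j)
least-witness P P? (m , Pm) = search m 0 Pm (λ _ ())
  where
  search : ∀ fuel start → P (start + fuel) → (∀ j → j < start → ¬ P j) →
           ∃[ m ] (P m × ∀ j → P j → m ≤ j)
  search fuel start P[start+fuel] below with P? start
  ... | yes Pstart = start , Pstart , λ j Pj → ≮⇒≥ (λ j<start → below j j<start Pj)
  search zero start P[start+0] below | no ¬Pstart =
    ⊥-elim (¬Pstart (subst P (+-identityʳ start) P[start+0]))
  search (suc fuel) start P[start+fuel] below | no ¬Pstart =
    search fuel (suc start) (subst P (+-suc start fuel) P[start+fuel]) below′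
    where
    below′ : ∀ j → j < suc start → ¬ P j
    below′ j j<1+start with m<1+n⇒m<n∨m≡n j<1+start
    ... | inj₁ j<start = below j j<start
    ... | inj₂ refl    = ¬Pstart

Near : ℕ → ℕ → Set
Near x k = k ≤ x × x ≤ suc k

near-determined : ∀ {x k l} → Near x k → Near x l →
                  (k≟x : Dec (k ≡ x)) (l≟x : Dec (l ≡ x)) → does k≟x ≡ does l≟x → k ≡ l
near-determined _ _ (yes k≡x) (yes l≡x) _ = trans k≡x (sym l≡x)
near-determined {x} (k≤x , x≤1+k) (l≤x , x≤1+l) (no k≢x) (no l≢x) _ =
  suc-injective (trans (predecessor k≤x k≢x x≤1+k) (sym (predecessor l≤x l≢x x≤1+l)))
  where
  predecessor : ∀ {m} → m ≤ x → m ≢ x → x ≤ suc m → suc m ≡ x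
  predecessor m≤x m≢x x≤1+m = ≤-antisym (≤∧≢⇒< m≤x m≢x) x≤1+m
near-determined _ _ (yes _) (no _) ()
near-determined _ _ (no _)  (yes _) ()

elemAt : ∀ {n} (p : Subset n) → Fin ∣ p ∣ → Fin n
elemAt (inside  ∷ p) zero    = zero
elemAt (inside  ∷ p) (suc i) = suc (elemAt p i)
elemAt (outside ∷ p) i       = suc (elemAt p i)

elemAt-∈ : ∀ {n} (p : Subset n) (i : Fin ∣ p ∣) → elemAt p i ∈ p
elemAt-∈ (inside  ∷ p) zero    = here
elemAt-∈ (inside  ∷ p) (suc i) = there (elemAt-∈ p i)
elemAt-∈ (outside ∷ p) i       = there (elemAt-∈ p i)

elemAt-injective : ∀ {n} (p : Subset n) → Injective _≡_ _≡_ (elemAt p)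
elemAt-injective (inside  ∷ p) {zero}  {zero}  _  = refl
elemAt-injective (inside  ∷ p) {suc i} {suc j} eq =
  cong suc (elemAt-injective p (Fin.suc-injective eq))
elemAt-injective (outside ∷ p) eq = elemAt-injective p (Fin.suc-injective eq)

module _ (G : Graph) where
  open Graph G using (n; adj; irrefl) renaming (sym to adj-sym)

  snoc : ∀ {w u u′ k} → Walk G w u k → T (adj u u′) → Walk G w u′ (suc k)
  snoc here       a = step a here
  snoc (step b p) a = step b (snoc p a)

  walk? : ∀ k u v → Dec (Walk G u v k)
  walk? zero u v with u Fin.≟ v
  ... | yes refl = yes here
  ... | no  u≢v  = no λ { here → u≢v refl }
  walk? (suc k) u v with Fin.any? (λ w → T? (adj u w) ×-dec walk? k w v)
  ... | yes (w , a , p) = yes (step a p)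
  ... | no  none        = no λ { (step a p) → none (_ , a , p) }

  neighbour : (v : Fin n) → Fin (deg G v) → Fin n
  neighbour v = elemAt (tabulate (adj v))

  neighbour-adj : ∀ v i → T (adj v (neighbour v i))
  neighbour-adj v i = Equivalence.from T-≡
    (trans (sym (lookup∘tabulate (adj v) (neighbour v i)))
           ([]=⇒lookup (elemAt-∈ (tabulate (adj v)) i)))

  -- The edge joining v and u, with its endpoints in the order IsElem requires.
  edgeAt : Fin n → Fin n → Elem G
  edgeAt v u with u <? v
  ... | yes _ = edge u v
  ... | no  _ = edge v u

  edgeAt-isElem : ∀ {v u} → T (adj v u) → IsElem G (edgeAt v u)
  edgeAt-isElem {v} {u} a with u <? v
  ... | yes u<v = u<v , subst T (adj-sym v u) a
  ... | no  u≮v = Fin.≤∧≢⇒< (≮⇒≥ u≮v) v≢u , a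
    where
    v≢u : v ≢ u
    v≢u refl = subst T (irrefl v) a

  edgeAt-injective : ∀ {v u u′} → edgeAt v u ≡ edgeAt v u′ → u ≡ u′
  edgeAt-injective {v} {u} {u′} eq with u <? v | u′ <? v
  edgeAt-injective refl | yes _ | yes _ = refl
  edgeAt-injective refl | yes _ | no  _ = refl
  edgeAt-injective refl | no  _ | yes _ = refl
  edgeAt-injective refl | no  _ | no  _ = refl

  vertex≢edgeAt : ∀ v u → vertex v ≢ edgeAt v u
  vertex≢edgeAt v u with u <? v
  ... | yes _ = λ ()
  ... | no  _ = λ ()

  module _ (connected : Connected G) where

    dist-exists : ∀ w u → ∃[ k ] IsDist G w u k
    dist-exists w u = least-witness (λ k → Walk G w u k) (λ k → walk? k w u) (connected w u)

    dist : Fin n → Fin n → ℕ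
    dist w u = proj₁ (dist-exists w u)

    dist-isDist : ∀ w u → IsDist G w u (dist w u)
    dist-isDist w u = proj₂ (dist-exists w u)

    dist-self : ∀ v → dist v v ≡ 0
    dist-self v = n≤0⇒n≡0 (proj₂ (dist-isDist v v) 0 here)

    dist-step : ∀ w {u u′} → T (adj u u′) → dist w u′ ≤ suc (dist w u)
    dist-step w {u} {u′} a = proj₂ (dist-isDist w u′) _ (snoc (proj₁ (dist-isDist w u)) a)

    star : (v : Fin n) → Fin (suc (deg G v)) → Elem G
    star v zero    = vertex v
    star v (suc i) = edgeAt v (neighbour v i)

    star-isElem : ∀ v i → IsElem G (star v i)
    star-isElem v zero    = tt
    star-isElem v (suc i) = edgeAt-isElem (neighbour-adj v i)

    star-injective : ∀ v → Injective _≡_ _≡_ (star v)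
    star-injective v {zero}  {zero}  _  = refl
    star-injective v {zero}  {suc j} eq = ⊥-elim (vertex≢edgeAt v _ eq)
    star-injective v {suc i} {zero}  eq = ⊥-elim (vertex≢edgeAt v _ (sym eq))
    star-injective v {suc i} {suc j} eq =
      cong suc (elemAt-injective (tabulate (adj v)) (edgeAt-injective eq))

    -- The distance from w to the i-th member of the star of v; for an edge it
    -- is min(d(w,v), d(w,u)) whichever way the endpoints are ordered.
    starDist : (v w : Fin n) → Fin (suc (deg G v)) → ℕ
    starDist v w zero    = dist w v
    starDist v w (suc i) = dist w v ⊓ dist w (neighbour v i)

    starDist-isDist : ∀ v w i → IsDistE G w (star v i) (starDist v w i)
    starDist-isDist v w zero = dist-isDist w v
    starDist-isDist v w (suc i) with neighbour v i <? v
    ... | yes _ = dist w (neighbour v i) , dist w v ,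
                  dist-isDist w (neighbour v i) , dist-isDist w v , ⊓-comm (dist w v) _
    ... | no  _ = dist w v , dist w (neighbour v i) ,
                  dist-isDist w v , dist-isDist w (neighbour v i) , refl

    starDist-near : ∀ v w i → Near (dist w v) (starDist v w i)
    starDist-near v w zero    = ≤-refl , n≤1+n (dist w v)
    starDist-near v w (suc i) =
      m⊓n≤m (dist w v) _ ,
      ⊓-glb (n≤1+n (dist w v)) (dist-step w (subst T (adj-sym v _) (neighbour-adj v i)))

    starDist-at-v : ∀ v i → starDist v v i ≡ dist v v
    starDist-at-v v i = ≤-antisym (proj₁ (starDist-near v v i))
                                  (subst (_≤ starDist v v i) (sym (dist-self v)) z≤n)

    resolving-vertex-degree : ∀ v S → IsMixedResolving G S → v ∈ S →
                              2 * suc (deg G v) ≤ 2 ^ ∣ S ∣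
    resolving-vertex-degree v S resolving v∈S =
      agreeing-codes-bound S v∈S code agree-at-v separated
      where
      code : Fin (suc (deg G v)) → Fin n → Bool
      code i w = does (starDist v w i ≟ dist w v)

      code-at-v : ∀ i → code i v ≡ true
      code-at-v i = dec-true (starDist v v i ≟ dist v v) (starDist-at-v v i)

      agree-at-v : ∀ i j → code i v ≡ code j v
      agree-at-v i j = trans (code-at-v i) (sym (code-at-v j))

      separated : ∀ {i j} → i ≢ j → Separates S (code i) (code j)
      separated {i} {j} i≢j
        with w , w∈S , resolves ← resolving (star v i) (star v j)
               (star-isElem v i) (star-isElem v j) (i≢j ∘ star-injective v)
        = w , w∈S , λ same → resolves _ _ (starDist-isDist v w i) (starDist-isDist v w j)
            (near-determined (starDist-near v w i) (starDist-near v w j)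
              (starDist v w i ≟ dist w v) (starDist v w j ≟ dist w v) same)

corollary2 : (G : Graph) → Connected G → (b : ℕ) → IsMixedMetricDim G b →
             (v : Fin (Graph.n G)) → 2 ^ b < 2 * suc (deg G v) →
             (S : Subset (Graph.n G)) → IsMixedResolving G S → ∣ S ∣ ≡ b → v ∉ S
corollary2 G connected _ _ v degree-large S resolving refl v∈S =
  <⇒≱ degree-large (resolving-vertex-degree G connected v S resolving v∈S)
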